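{- Let $a_n=|B_n(123,213)|$. Then $a_n=1$ if $n=1$ or $n$ is even, and $a_n=2$ otherwise (i.e. for odd $n\ge 3$).
   Context: A permutation $\sigma\in S_n$ is written as $\sigma(1)\cdots\sigma(n)$. An index $i\in[n-1]$ is an ascent if $\sigma(i)<\sigma(i+1)$ and a descent if $\sigma(i)>\sigma(i+1)$. A ballot permutation is a permutation such that every prefix $\sigma(1)\cdots\sigma(p)$ has at least as many ascents as descents. $\sigma$ contains a pattern $\pi\in S_k$ if some subsequence $\sigma(c_1)\cdots\sigma(c_k)$ with $c_1<\dots<c_k$ is order-isomorphic to $\pi$, and avoids $\pi$ otherwise. $B_n(\pi_1,\dots,\pi_m)$ denotes the set of ballot permutations of length $n$ avoiding all of $\pi_1,\dots,\pi_m$. -}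

module Defs where

open import Data.Bool using (Bool; true; false; _∧_; _∨_; not; T)
open import Data.Nat using (ℕ; zero; suc; _≤ᵇ_; _<ᵇ_; _≡ᵇ_)
open import Data.Fin using (Fin; toℕ)
open import Data.List using (List; []; _∷_; map; length; inits; zip; filterᵇ; _++_)
open import Data.Bool.ListAction using (all; any)
open import Data.Vec using (Vec; toList)
open import Data.Product using (Σ; _×_; _,_; proj₁; proj₂)

-- A permutation of length n: a word σ(1)⋯σ(n) with entries in Fin n that
-- are pairwise distinct (hence a bijection [n] → [n]).
notElem : ℕ → List ℕ → Bool
notElem x [] = true
notElem x (y ∷ ys) = not (x ≡ᵇ y) ∧ notElem x ys

allDistinct : List ℕ → Bool
allDistinct [] = true
allDistinct (x ∷ xs) = notElem x xs ∧ allDistinct xs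

adjPairs : List ℕ → List (ℕ × ℕ)
adjPairs [] = []
adjPairs (x ∷ xs) = zip (x ∷ xs) xs

ascents : List ℕ → ℕ
ascents w = length (filterᵇ (λ p → proj₁ p <ᵇ proj₂ p) (adjPairs w))

descents : List ℕ → ℕ
descents w = length (filterᵇ (λ p → proj₂ p <ᵇ proj₁ p) (adjPairs w))

isBallot : List ℕ → Bool
isBallot w = all (λ p → descents p ≤ᵇ ascents p) (inits w)

subseqs : List ℕ → List (List ℕ)
subseqs [] = [] ∷ []
subseqs (x ∷ xs) = map (x ∷_) (subseqs xs) ++ subseqs xs

orderIso : List ℕ → List ℕ → Bool
orderIso u v = (length u ≡ᵇ length v) ∧
  all (λ p → all (λ q → eqB (proj₁ p <ᵇ proj₁ q)
                            (proj₂ p <ᵇ proj₂ q))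
                 (zip u v))
      (zip u v)
  where
  eqB : Bool → Bool → Bool
  eqB true b = b
  eqB false b = not b

contains : List ℕ → List ℕ → Bool
contains σ π = any (orderIso π) (subseqs σ)

avoids : List ℕ → List ℕ → Bool
avoids σ π = not (contains σ π)

word : ∀ {n} → Vec (Fin n) n → List ℕ
word σ = map toℕ (toList σ)

inB : (n : ℕ) → Vec (Fin n) n → Bool
inB n σ = allDistinct (word σ) ∧ isBallot (word σ)
          ∧ avoids (word σ) (1 ∷ 2 ∷ 3 ∷ []) ∧ avoids (word σ) (2 ∷ 1 ∷ 3 ∷ [])

-- the set B_n(123,213) as a type (T b is proof-irrelevant, so elements are
-- determined by their underlying word)
B-123-213 : ℕ → Set
B-123-213 n = Σ (Vec (Fin n) n) (λ σ → T (inB n σ))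

isEven : ℕ → Bool
isEven zero = true
isEven (suc zero) = false
isEven (suc (suc n)) = isEven n

a : ℕ → ℕ
a n = if (n ≡ᵇ 1) ∨ isEven n then 1 else 2
  where open import Data.Bool using (if_then_else_)

-- Avoiding both 123 and 213 means that every entry has at most one smaller entry to its left.
-- With the ballot condition this forces every even-length prefix to be layered: a sequence of
-- ascending pairs p₁q₁ p₂q₂ ⋯ in which each pair lies above all later ones. Such a prefix has one
-- more ascent than descents, and the next entry r lies below the top of the last pair, which
-- balances the count; so the entry s after r must exceed r, and then s lies below everything
-- before r. A layered word on a given interval of values is unique (consecutive pairs from the
-- top down), which gives a_n = 1 for even n. For odd n (values 0, …, n − 1) the last entry is
-- either 0, below everything, or lies inside the last pair, which forces the ending 0 2 1; both
-- words are admissible, so a_n = 2.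

module Submission where

open import Defs
open import Data.Nat using (ℕ; _≤_)
open import Data.Fin using (Fin)
open import Function.Bundles using (_↔_)

open import Data.Bool using (Bool; true; false; _∧_; not; T)
open import Data.Bool.Properties using (T-∧; T-≡; T-not-≡; T-irrelevant)
open import Data.Empty using (⊥; ⊥-elim)
open import Data.Fin using (toℕ; fromℕ<) renaming (zero to fzero; suc to fsuc)
open import Data.Fin.Properties using (toℕ-injective; toℕ-fromℕ<; toℕ<n)
open import Data.List using (List; []; _∷_; [_]; _++_; map; length; inits; filterᵇ)
open import Data.List.Properties
  using (∷-injectiveˡ; ∷-injectiveʳ; ∷ʳ-injective; map-++; filter-++; length-++; ++-assoc)
open import Data.List.Membership.Propositional using (_∈_; _∉_; find)
open import Data.List.Membership.Propositional.Properties using (∈-++⁺ˡ; ∈-++⁺ʳ; ∈-++⁻; ∈-map⁺; ∈-map⁻)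
open import Data.List.Relation.Binary.Sublist.Propositional using (_⊆_; []; _∷_; _∷ʳ_; ⊆-refl; from∈)
open import Data.List.Relation.Binary.Sublist.Propositional.Properties using (++⁺; ++⁺ˡ; ++⁺ʳ; Any-resp-⊆)
open import Data.List.Relation.Unary.All using (All; []; _∷_)
import Data.List.Relation.Unary.All as All
open import Data.List.Relation.Unary.All.Properties
  using (all⁺; all⁻; ∷ʳ⁻; ∷ʳ⁺) renaming (++⁻ to All-++⁻; ++⁺ to All-++⁺)
open import Data.List.Relation.Unary.Any using (here; there)
import Data.List.Relation.Unary.Any as Any
open import Data.List.Relation.Unary.Any.Properties using (any⁺; any⁻)
open import Data.Nat using (zero; suc; z≤n; s≤s; s≤s⁻¹; _+_; _<_; _≤ᵇ_; _<ᵇ_; _≡ᵇ_)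
open import Data.Nat.Properties
  using ( <⇒<ᵇ; <ᵇ⇒<; ≡ᵇ⇒≡; ≡⇒≡ᵇ; ≤ᵇ⇒≤; ≤⇒≤ᵇ; ≤-refl; ≤-reflexive; ≤-trans; ≤-antisym; <-irrefl; <-asym
        ; <-trans; ≤-<-trans; <-≤-trans; <⇒≤; <⇒≱; <-cmp; n≤1+n; n<1+n; m≤m+n; suc-injective; +-comm; +-suc
        ; +-identityʳ; +-monoˡ-≤; +-monoʳ-≤; +-monoʳ-<; +-cancelʳ-≤; module ≤-Reasoning )
open import Data.Product using (_×_; _,_; proj₁; proj₂; ∃-syntax)
open import Data.Sum using (_⊎_; inj₁; inj₂)
open import Data.Vec using (Vec; toList) renaming ([] to []ᵥ; _∷_ to _∷ᵥ_)
open import Function.Base using (_∘_)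
open import Function.Bundles using (Equivalence; mk↔ₛ′)
open import Relation.Binary using (tri<; tri≈; tri>)
open import Relation.Binary.PropositionalEquality using (_≡_; _≢_; refl; sym; trans; cong; cong₂; subst)
open import Relation.Nullary using (¬_)
open import Relation.Nullary.Decidable using (T?)

¬T⇒T-not : ∀ {b} → ¬ T b → T (not b)
¬T⇒T-not {false} _ = _
¬T⇒T-not {true} ¬t = ¬t _

T-not⇒¬T : ∀ {b} → T (not b) → ¬ T b
T-not⇒¬T {true} ()

<ᵇ-true : ∀ {m n} → m < n → (m <ᵇ n) ≡ true
<ᵇ-true m<n = Equivalence.to T-≡ (<⇒<ᵇ m<n)

<ᵇ-false : ∀ {m n} → n ≤ m → (m <ᵇ n) ≡ false
<ᵇ-false n≤m = Equivalence.to T-not-≡ (¬T⇒T-not (λ m<ᵇn → <⇒≱ (<ᵇ⇒< _ _ m<ᵇn) n≤m))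

-- Subsequences and patterns

∈-subseqs⁺ : ∀ {s w} → s ⊆ w → s ∈ subseqs w
∈-subseqs⁺ [] = here refl
∈-subseqs⁺ {w = x ∷ w} (x ∷ʳ τ) = ∈-++⁺ʳ (map (x ∷_) (subseqs w)) (∈-subseqs⁺ τ)
∈-subseqs⁺ (refl ∷ τ) = ∈-++⁺ˡ (∈-map⁺ _ (∈-subseqs⁺ τ))

∈-subseqs⁻ : ∀ {s} w → s ∈ subseqs w → s ⊆ w
∈-subseqs⁻ [] (here refl) = []
∈-subseqs⁻ (x ∷ w) s∈ with ∈-++⁻ (map (x ∷_) (subseqs w)) s∈
... | inj₂ s∈′ = x ∷ʳ ∈-subseqs⁻ w s∈′
... | inj₁ s∈map with ∈-map⁻ (x ∷_) s∈map
...   | t , t∈ , refl = refl ∷ ∈-subseqs⁻ w t∈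

contains⁺ : ∀ {s w} π → s ⊆ w → T (orderIso π s) → T (contains w π)
contains⁺ π τ iso = any⁺ (orderIso π) (Any.map (λ { refl → iso }) (∈-subseqs⁺ τ))

contains⁻ : ∀ w π → T (contains w π) → ∃[ s ] s ⊆ w × T (orderIso π s)
contains⁻ w π c with find (any⁻ (orderIso π) (subseqs w) c)
... | s , s∈ , iso = s , ∈-subseqs⁻ w s∈ , iso

⊆-++[]⁻ : ∀ {A : Set} {s : List A} w z → s ⊆ w ++ [ z ] → s ⊆ w ⊎ ∃[ s′ ] s ≡ s′ ++ [ z ] × s′ ⊆ w
⊆-++[]⁻ [] z (z ∷ʳ []) = inj₁ []
⊆-++[]⁻ [] z (refl ∷ []) = inj₂ ([] , refl , [])
⊆-++[]⁻ (x ∷ w) z (x ∷ʳ τ) with ⊆-++[]⁻ w z τ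
... | inj₁ τ′ = inj₁ (x ∷ʳ τ′)
... | inj₂ (s′ , refl , τ′) = inj₂ (s′ , refl , x ∷ʳ τ′)
⊆-++[]⁻ (x ∷ w) z (refl ∷ τ) with ⊆-++[]⁻ w z τ
... | inj₁ τ′ = inj₁ (refl ∷ τ′)
... | inj₂ (s′ , refl , τ′) = inj₂ (x ∷ s′ , refl , refl ∷ τ′)

orderIso-length : ∀ π s → T (orderIso π s) → length π ≡ length s
orderIso-length π s iso =
  ≡ᵇ⇒≡ (length π) (length s) (proj₁ (Equivalence.to (T-∧ {length π ≡ᵇ length s}) iso))

avoids-++[]⁻ : ∀ π w z → T (avoids (w ++ [ z ]) π) →
  T (avoids w π) × (∀ {x y} → x ∷ y ∷ [] ⊆ w → ¬ T (orderIso π (x ∷ y ∷ z ∷ [])))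
avoids-++[]⁻ π w z av =
  ¬T⇒T-not (λ c → let (s , τ , iso) = contains⁻ w π c
                   in T-not⇒¬T av (contains⁺ π (++⁺ʳ [ z ] τ) iso)) ,
  λ τ iso → T-not⇒¬T av (contains⁺ π (++⁺ τ (refl ∷ [])) iso)

avoids-++[]⁺ : ∀ π w z → length π ≡ 3 → T (avoids w π) →
  (∀ {x y} → x ∷ y ∷ [] ⊆ w → ¬ T (orderIso π (x ∷ y ∷ z ∷ []))) → T (avoids (w ++ [ z ]) π)
avoids-++[]⁺ π w z len av noEnding = ¬T⇒T-not λ c →
  let (s , τ , iso) = contains⁻ (w ++ [ z ]) π c in no-occurrence τ iso (trans (sym (orderIso-length π s iso)) len)
  where
  no-occurrence : ∀ {s} → s ⊆ w ++ [ z ] → T (orderIso π s) → length s ≡ 3 → ⊥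
  no-occurrence {a ∷ b ∷ c ∷ []} τ iso refl with ⊆-++[]⁻ w z τ
  ... | inj₁ τ′ = T-not⇒¬T av (contains⁺ π τ′ iso)
  ... | inj₂ (s′ , e , τ′) with ∷ʳ-injective (a ∷ b ∷ []) s′ e
  ...   | refl , refl = noEnding τ′ iso

π123 π213 : List ℕ
π123 = 1 ∷ 2 ∷ 3 ∷ []
π213 = 2 ∷ 1 ∷ 3 ∷ []

-- Both patterns end in their maximum, and on three letters orderIso unfolds to a 3 × 3 table of
-- comparisons, row by row; its last column says that the first two letters are below the third.
last-column : ∀ a₁ a₂ a₃ b₁ b₂ b₃ c₁ c₂ c₃ →
  T ((a₁ ∧ a₂ ∧ a₃ ∧ true) ∧ (b₁ ∧ b₂ ∧ b₃ ∧ true) ∧ (c₁ ∧ c₂ ∧ c₃ ∧ true) ∧ true) → T a₃ × T b₃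
last-column true true true true true true _ _ _ _ = _ , _
last-column true true true true true false _ _ _ ()
last-column true true true true false _ _ _ _ ()
last-column true true true false _ _ _ _ _ ()
last-column true true false _ _ _ _ _ _ ()
last-column true false _ _ _ _ _ _ _ ()
last-column false _ _ _ _ _ _ _ _ ()

orderIso-123⁻ : ∀ x y z → T (orderIso π123 (x ∷ y ∷ z ∷ [])) → x < z × y < z
orderIso-123⁻ x y z iso
  with last-column (not (x <ᵇ x)) (x <ᵇ y) (x <ᵇ z) (not (y <ᵇ x)) (not (y <ᵇ y)) (y <ᵇ z)
                   (not (z <ᵇ x)) (not (z <ᵇ y)) (not (z <ᵇ z)) iso
... | x<ᵇz , y<ᵇz = <ᵇ⇒< x z x<ᵇz , <ᵇ⇒< y z y<ᵇz

orderIso-213⁻ : ∀ x y z → T (orderIso π213 (x ∷ y ∷ z ∷ [])) → x < z × y < z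
orderIso-213⁻ x y z iso
  with last-column (not (x <ᵇ x)) (not (x <ᵇ y)) (x <ᵇ z) (y <ᵇ x) (not (y <ᵇ y)) (y <ᵇ z)
                   (not (z <ᵇ x)) (not (z <ᵇ y)) (not (z <ᵇ z)) iso
... | x<ᵇz , y<ᵇz = <ᵇ⇒< x z x<ᵇz , <ᵇ⇒< y z y<ᵇz

orderIso-123⁺ : ∀ {x y z} → x < y → y < z → T (orderIso π123 (x ∷ y ∷ z ∷ []))
orderIso-123⁺ {x} {y} {z} x<y y<z
  rewrite <ᵇ-true x<y | <ᵇ-true y<z | <ᵇ-true (<-trans x<y y<z)
        | <ᵇ-false (≤-refl {x}) | <ᵇ-false (≤-refl {y}) | <ᵇ-false (≤-refl {z})
        | <ᵇ-false (<⇒≤ x<y) | <ᵇ-false (<⇒≤ y<z) | <ᵇ-false (<⇒≤ (<-trans x<y y<z)) = _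

orderIso-213⁺ : ∀ {x y z} → y < x → x < z → T (orderIso π213 (x ∷ y ∷ z ∷ []))
orderIso-213⁺ {x} {y} {z} y<x x<z
  rewrite <ᵇ-true y<x | <ᵇ-true x<z | <ᵇ-true (<-trans y<x x<z)
        | <ᵇ-false (≤-refl {x}) | <ᵇ-false (≤-refl {y}) | <ᵇ-false (≤-refl {z})
        | <ᵇ-false (<⇒≤ y<x) | <ᵇ-false (<⇒≤ x<z) | <ᵇ-false (<⇒≤ (<-trans y<x x<z)) = _

notElem⇒∉ : ∀ {x} w → T (notElem x w) → x ∉ w
notElem⇒∉ {x} (y ∷ w) x∉ x∈ with Equivalence.to (T-∧ {not (x ≡ᵇ y)}) x∉ | x∈
... | x≢y , _ | here refl = T-not⇒¬T x≢y (≡⇒≡ᵇ x x refl)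
... | _ , x∉w | there x∈w = notElem⇒∉ w x∉w x∈w

∉⇒notElem : ∀ {x} w → x ∉ w → T (notElem x w)
∉⇒notElem [] _ = _
∉⇒notElem {x} (y ∷ w) x∉ =
  Equivalence.from T-∧ (¬T⇒T-not (λ x≡y → x∉ (here (≡ᵇ⇒≡ x y x≡y))) , ∉⇒notElem w (x∉ ∘ there))

allDistinct-++[]⁻ : ∀ w z → T (allDistinct (w ++ [ z ])) → T (allDistinct w) × z ∉ w
allDistinct-++[]⁻ [] z _ = _ , λ ()
allDistinct-++[]⁻ (x ∷ w) z d with Equivalence.to (T-∧ {notElem x (w ++ [ z ])}) d
... | x∉ , dw with allDistinct-++[]⁻ w z dw
...   | dw′ , z∉w = Equivalence.from T-∧ (∉⇒notElem w (notElem⇒∉ _ x∉ ∘ ∈-++⁺ˡ) , dw′) , z∉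
  where
  z∉ : z ∉ x ∷ w
  z∉ (here refl) = notElem⇒∉ _ x∉ (∈-++⁺ʳ w (here refl))
  z∉ (there z∈w) = z∉w z∈w

allDistinct-++[]⁺ : ∀ w z → T (allDistinct w) → z ∉ w → T (allDistinct (w ++ [ z ]))
allDistinct-++[]⁺ [] z _ _ = _
allDistinct-++[]⁺ (x ∷ w) z d z∉ with Equivalence.to (T-∧ {notElem x w}) d
... | x∉w , dw = Equivalence.from T-∧ (∉⇒notElem (w ++ [ z ]) x∉ , allDistinct-++[]⁺ w z dw (z∉ ∘ there))
  where
  x∉ : x ∉ w ++ [ z ]
  x∉ x∈ with ∈-++⁻ w x∈
  ... | inj₁ x∈w = notElem⇒∉ w x∉w x∈w
  ... | inj₂ (here refl) = z∉ (here refl)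

allDistinct-pair : ∀ {x y} w → T (allDistinct w) → x ∷ y ∷ [] ⊆ w → x ≢ y
allDistinct-pair (u ∷ w) d (u ∷ʳ τ) = allDistinct-pair w (proj₂ (Equivalence.to (T-∧ {notElem u w}) d)) τ
allDistinct-pair (u ∷ w) d (refl ∷ τ) refl =
  notElem⇒∉ w (proj₁ (Equivalence.to (T-∧ {notElem u w}) d)) (Any-resp-⊆ τ (here refl))

-- Ascents, descents and ballot words

inits-++[] : ∀ {A : Set} (w : List A) z → inits (w ++ [ z ]) ≡ inits w ++ [ w ++ [ z ] ]
inits-++[] [] z = refl
inits-++[] (x ∷ w) z = cong ([] ∷_) (trans (cong (map (x ∷_)) (inits-++[] w z)) (map-++ (x ∷_) (inits w) _))

ascentsDominate : List ℕ → Bool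
ascentsDominate p = descents p ≤ᵇ ascents p

isBallot-++[]⁻ : ∀ w z → T (isBallot (w ++ [ z ])) →
  T (isBallot w) × descents (w ++ [ z ]) ≤ ascents (w ++ [ z ])
isBallot-++[]⁻ w z b
  with ∷ʳ⁻ {xs = inits w} {x = w ++ [ z ]}
           (subst (All (T ∘ ascentsDominate)) (inits-++[] w z) (all⁺ ascentsDominate (inits (w ++ [ z ])) b))
... | prefixes , whole = all⁻ ascentsDominate prefixes , ≤ᵇ⇒≤ _ _ whole

isBallot-++[]⁺ : ∀ w z → T (isBallot w) → descents (w ++ [ z ]) ≤ ascents (w ++ [ z ]) →
  T (isBallot (w ++ [ z ]))
isBallot-++[]⁺ w z b bz =
  all⁻ ascentsDominate (subst (All (T ∘ ascentsDominate)) (sym (inits-++[] w z))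
    (∷ʳ⁺ {xs = inits w} {x = w ++ [ z ]} (all⁺ ascentsDominate (inits w) b) (≤⇒≤ᵇ bz)))

adjPairs-++ : ∀ u x v → adjPairs (u ++ x ∷ v) ≡ adjPairs (u ++ [ x ]) ++ adjPairs (x ∷ v)
adjPairs-++ [] x v = refl
adjPairs-++ (a ∷ []) x v = refl
adjPairs-++ (a ∷ b ∷ u) x v = cong ((a , b) ∷_) (adjPairs-++ (b ∷ u) x v)

countAdjacent : (ℕ × ℕ → Bool) → List ℕ → ℕ
countAdjacent P w = length (filterᵇ P (adjPairs w))

countAdjacent-++ : ∀ P u x v →
  countAdjacent P (u ++ x ∷ v) ≡ countAdjacent P (u ++ [ x ]) + countAdjacent P (x ∷ v)
countAdjacent-++ P u x v rewrite adjPairs-++ u x v =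
  trans (cong length (filter-++ (T? ∘ P) (adjPairs (u ++ [ x ])) (adjPairs (x ∷ v))))
        (length-++ (filterᵇ P (adjPairs (u ++ [ x ]))))

ascents-++ : ∀ u x v → ascents (u ++ x ∷ v) ≡ ascents (u ++ [ x ]) + ascents (x ∷ v)
ascents-++ = countAdjacent-++ (λ p → proj₁ p <ᵇ proj₂ p)

descents-++ : ∀ u x v → descents (u ++ x ∷ v) ≡ descents (u ++ [ x ]) + descents (x ∷ v)
descents-++ = countAdjacent-++ (λ p → proj₂ p <ᵇ proj₁ p)

ascents-↑ : ∀ {x y} w → x < y → ascents (x ∷ y ∷ w) ≡ suc (ascents (y ∷ w))
ascents-↑ w x<y rewrite <ᵇ-true x<y = refl

ascents-↓ : ∀ {x y} w → y < x → ascents (x ∷ y ∷ w) ≡ ascents (y ∷ w)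
ascents-↓ w y<x rewrite <ᵇ-false (<⇒≤ y<x) = refl

descents-↑ : ∀ {x y} w → x < y → descents (x ∷ y ∷ w) ≡ descents (y ∷ w)
descents-↑ w x<y rewrite <ᵇ-false (<⇒≤ x<y) = refl

descents-↓ : ∀ {x y} w → y < x → descents (x ∷ y ∷ w) ≡ suc (descents (y ∷ w))
descents-↓ w y<x rewrite <ᵇ-true y<x = refl

Admissible : List ℕ → Set
Admissible w = T (allDistinct w) × T (isBallot w) × T (avoids w π123) × T (avoids w π213)

NoTwoBelow : List ℕ → ℕ → Set
NoTwoBelow w z = ∀ {x y} → x ∷ y ∷ [] ⊆ w → x < z → y < z → ⊥

admissible-++[]⁻ : ∀ w z → Admissible (w ++ [ z ]) →
  Admissible w × z ∉ w × descents (w ++ [ z ]) ≤ ascents (w ++ [ z ]) × NoTwoBelow w z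
admissible-++[]⁻ w z (d , b , a₁₂₃ , a₂₁₃)
  with allDistinct-++[]⁻ w z d | isBallot-++[]⁻ w z b
     | avoids-++[]⁻ π123 w z a₁₂₃ | avoids-++[]⁻ π213 w z a₂₁₃
... | dw , z∉w | bw , ballot | a₁₂₃′ , no123 | a₂₁₃′ , no213 =
  (dw , bw , a₁₂₃′ , a₂₁₃′) , z∉w , ballot , noTwo
  where
  noTwo : NoTwoBelow w z
  noTwo {x} {y} τ x<z y<z with <-cmp x y
  ... | tri< x<y _ _ = no123 τ (orderIso-123⁺ x<y y<z)
  ... | tri≈ _ x≡y _ = allDistinct-pair w dw τ x≡y
  ... | tri> _ _ y<x = no213 τ (orderIso-213⁺ y<x x<z)

admissible-++[]⁺ : ∀ w z → Admissible w → z ∉ w → descents (w ++ [ z ]) ≤ ascents (w ++ [ z ]) →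
  NoTwoBelow w z → Admissible (w ++ [ z ])
admissible-++[]⁺ w z (d , b , a₁₂₃ , a₂₁₃) z∉w ballot noTwo =
  allDistinct-++[]⁺ w z d z∉w ,
  isBallot-++[]⁺ w z b ballot ,
  avoids-++[]⁺ π123 w z refl a₁₂₃ (λ τ iso → let (x<z , y<z) = orderIso-123⁻ _ _ z iso in noTwo τ x<z y<z) ,
  avoids-++[]⁺ π213 w z refl a₂₁₃ (λ τ iso → let (x<z , y<z) = orderIso-213⁻ _ _ z iso in noTwo τ x<z y<z)

noTwoBelow-unique : ∀ {w z} m → T (allDistinct w) → (∀ {t} → t ∈ w → t < z → t ≡ m) → NoTwoBelow w z
noTwoBelow-unique {w} m d onlyM τ x<z y<z =
  allDistinct-pair w d τ (trans (onlyM (Any-resp-⊆ τ (here refl)) x<z)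
                                (sym (onlyM (Any-resp-⊆ τ (there (here refl))) y<z)))

-- Layered words

data Layered : List ℕ → Set where
  []    : Layered []
  layer : ∀ {v p q} → Layered v → p < q → All (q <_) v → Layered (v ++ p ∷ q ∷ [])

All-++-pair⁻ : ∀ {P : ℕ → Set} v {p q} → All P (v ++ p ∷ q ∷ []) → All P v × P p × P q
All-++-pair⁻ v all with All-++⁻ v all
... | Pv , Pp ∷ Pq ∷ [] = Pv , Pp , Pq

layered-balanced : ∀ {v x} → Layered v → All (x <_) v → ascents (v ++ [ x ]) ≡ descents (v ++ [ x ])
layer-balanced : ∀ {v p q x} → Layered v → p < q → All (q <_) v → x < q →
  ascents ((v ++ p ∷ q ∷ []) ++ [ x ]) ≡ descents ((v ++ p ∷ q ∷ []) ++ [ x ])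

layered-balanced [] [] = refl
layered-balanced (layer {v} lv p<q q<v) x< = layer-balanced lv p<q q<v (proj₂ (proj₂ (All-++-pair⁻ v x<)))

layer-balanced {v} {p} {q} {x} lv p<q q<v x<q
  rewrite ++-assoc v (p ∷ q ∷ []) [ x ] | ascents-++ v p (q ∷ x ∷ []) | descents-++ v p (q ∷ x ∷ [])
        | ascents-↑ (x ∷ []) p<q | ascents-↓ [] x<q | descents-↑ (x ∷ []) p<q | descents-↓ [] x<q
        | layered-balanced lv (All.map (<-trans p<q) q<v) = refl

below-top : ∀ v {p q r} → p < q → r ∉ v ++ p ∷ q ∷ [] → NoTwoBelow (v ++ p ∷ q ∷ []) r → r < q
below-top v {p} {q} {r} p<q r∉ noTwo with <-cmp r q
... | tri< r<q _ _ = r<q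
... | tri≈ _ refl _ = ⊥-elim (r∉ (∈-++⁺ʳ v (there (here refl))))
... | tri> _ _ q<r = ⊥-elim (noTwo (++⁺ˡ v ⊆-refl) (<-trans p<q q<r) q<r)

no-descent-after-layered : ∀ {v r s} → Layered v → r ∉ v → NoTwoBelow v r →
  descents ((v ++ [ r ]) ++ [ s ]) ≤ ascents ((v ++ [ r ]) ++ [ s ]) → ¬ s < r
no-descent-after-layered [] _ _ ballot s<r rewrite descents-↓ [] s<r | ascents-↓ [] s<r with ballot
... | ()
no-descent-after-layered {r = r} {s} (layer {v} {p} {q} lv p<q q<v) r∉ noTwo ballot s<r =
  <⇒≱ more-descents (subst (λ w → descents w ≤ ascents w) regroup ballot)
  where
  r<q = below-top v p<q r∉ noTwo
  regroup : ((v ++ p ∷ q ∷ []) ++ [ r ]) ++ [ s ] ≡ v ++ p ∷ q ∷ r ∷ s ∷ []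
  regroup = trans (++-assoc (v ++ p ∷ q ∷ []) [ r ] [ s ]) (++-assoc v (p ∷ q ∷ []) (r ∷ s ∷ []))
  more-descents : ascents (v ++ p ∷ q ∷ r ∷ s ∷ []) < descents (v ++ p ∷ q ∷ r ∷ s ∷ [])
  more-descents
    rewrite ascents-++ v p (q ∷ r ∷ s ∷ []) | descents-++ v p (q ∷ r ∷ s ∷ [])
          | ascents-↑ (r ∷ s ∷ []) p<q | ascents-↓ (s ∷ []) r<q | ascents-↓ [] s<r
          | descents-↑ (r ∷ s ∷ []) p<q | descents-↓ (s ∷ []) r<q | descents-↓ [] s<r
          | layered-balanced lv (All.map (<-trans p<q) q<v) = +-monoʳ-< (descents (v ++ [ p ])) (n<1+n 1)

layered-++-pair : ∀ {v r s} → Layered v → Admissible ((v ++ [ r ]) ++ [ s ]) → Layered (v ++ r ∷ s ∷ [])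
layered-++-pair {v} {r} {s} lv adm with admissible-++[]⁻ (v ++ [ r ]) s adm
... | adm-vr , s∉vr , ballot , noTwoBelow-s with admissible-++[]⁻ v r adm-vr
...   | _ , r∉v , _ , noTwoBelow-r = layer lv r<s (All.tabulate s<)
  where
  r<s : r < s
  r<s with <-cmp r s
  ... | tri< r<s _ _ = r<s
  ... | tri≈ _ refl _ = ⊥-elim (s∉vr (∈-++⁺ʳ v (here refl)))
  ... | tri> _ _ s<r = ⊥-elim (no-descent-after-layered lv r∉v noTwoBelow-r ballot s<r)
  s< : ∀ {t} → t ∈ v → s < t
  s< {t} t∈v with <-cmp s t
  ... | tri< s<t _ _ = s<t
  ... | tri≈ _ refl _ = ⊥-elim (s∉vr (∈-++⁺ˡ t∈v))
  ... | tri> _ _ t<s = ⊥-elim (noTwoBelow-s (++⁺ (from∈ t∈v) (refl ∷ [])) t<s r<s)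

double : ℕ → ℕ
double zero = zero
double (suc k) = suc (suc (double k))

unsnoc-length : ∀ {A : Set} (w : List A) {m} → length w ≡ suc m → ∃[ v ] ∃[ z ] w ≡ v ++ [ z ] × length v ≡ m
unsnoc-length (x ∷ []) {zero} refl = [] , x , refl , refl
unsnoc-length (x ∷ y ∷ w) {suc m} len with unsnoc-length (y ∷ w) (suc-injective len)
... | v , z , w≡ , len-v = x ∷ v , z , cong (x ∷_) w≡ , cong suc len-v

admissible-even⇒layered : ∀ k w → length w ≡ double k → Admissible w → Layered w
admissible-even⇒layered zero [] _ _ = []
admissible-even⇒layered (suc k) w len adm with unsnoc-length w len
... | u , s , refl , len-u with unsnoc-length u len-u
...   | v , r , refl , len-v = subst Layered (sym (++-assoc v [ r ] [ s ])) (layered-++-pair layered-v adm)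
  where
  adm-v = proj₁ (admissible-++[]⁻ v r (proj₁ (admissible-++[]⁻ (v ++ [ r ]) s adm)))
  layered-v = admissible-even⇒layered k v len-v adm-v

length-++-pair : ∀ (v : List ℕ) p q → length (v ++ p ∷ q ∷ []) ≡ suc (suc (length v))
length-++-pair v p q = trans (length-++ v) (+-comm (length v) 2)

length-++-pair⁻ : ∀ v {p q k} → length (v ++ p ∷ q ∷ []) ≡ double (suc k) → length v ≡ double k
length-++-pair⁻ v {p} {q} len = suc-injective (suc-injective (trans (sym (length-++-pair v p q)) len))

-- A layered word climbs by at least one per entry, so its values span at least its length.
layered-span : ∀ {w c d} → Layered w → All (c ≤_) w → All (_< d) w → c ≤ d → c + length w ≤ d
layered-span {c = c} [] _ _ c≤d = subst (_≤ _) (sym (+-identityʳ c)) c≤d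
layered-span {c = c} {d} (layer {v} {p} {q} lv p<q q<v) c≤ <d _
  with All-++-pair⁻ v c≤ | All-++-pair⁻ v <d
... | _ , c≤p , _ | v<d , _ , q<d rewrite length-++-pair v p q = begin
    c + suc (suc (length v))  ≡⟨ +-suc c (suc (length v)) ⟩
    suc (c + suc (length v))  ≡⟨ cong suc (+-suc c (length v)) ⟩
    suc (suc c) + length v    ≤⟨ +-monoˡ-≤ (length v) (s≤s (≤-<-trans c≤p p<q)) ⟩
    suc q + length v          ≤⟨ layered-span lv q<v v<d q<d ⟩
    d                         ∎
  where open ≤-Reasoning

descendingPairs : ℕ → ℕ → List ℕ
descendingPairs b zero = []
descendingPairs b (suc k) = descendingPairs (suc (suc b)) k ++ b ∷ suc b ∷ []

+-double-suc : ∀ b k → b + double (suc k) ≡ suc (suc b) + double k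
+-double-suc b k = trans (+-suc b (suc (double k))) (cong suc (+-suc b (double k)))

bottom-pair : ∀ {b p q} → b ≤ p → p < q → q ≤ suc b → p ≡ b × q ≡ suc b
bottom-pair b≤p p<q q≤1+b = p≡b , ≤-antisym q≤1+b (subst (_< _) p≡b p<q)
  where p≡b = ≤-antisym (s≤s⁻¹ (<-≤-trans p<q q≤1+b)) b≤p

layered-floor : ∀ {w l c d} → Layered w → length w ≡ l → All (c ≤_) w → All (_< d + l) w → c ≤ d + l → c ≤ d
layered-floor {w} {c = c} {d} lw refl c≤ <top c≤top =
  +-cancelʳ-≤ (length w) c d (layered-span lw c≤ <top c≤top)

layered-unique : ∀ k b {w} → Layered w → length w ≡ double k → All (b ≤_) w → All (_< b + double k) w →
  w ≡ descendingPairs b k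
layered-unique zero b [] _ _ _ = refl
layered-unique zero b (layer {v} {p} {q} _ _ _) len _ _ with trans (sym (length-++-pair v p q)) len
... | ()
layered-unique (suc k) b (layer {v} {p} {q} lv p<q q<v) len b≤ <top
  with length-++-pair⁻ v len
... | len-v with All-++-pair⁻ v b≤ | All.map (λ {t} → subst (t <_) (+-double-suc b k)) <top
...   | _ , b≤p , _ | <top′ with All-++-pair⁻ v <top′
...     | v<top , _ , q<top with bottom-pair b≤p p<q (s≤s⁻¹ (layered-floor lv len-v q<v v<top q<top))
...       | refl , refl = cong (_++ b ∷ suc b ∷ []) (layered-unique k (suc (suc b)) lv len-v q<v v<top)


admissible-++-below : ∀ {v x} → Layered v → Admissible v → All (x <_) v → Admissible (v ++ [ x ])
admissible-++-below {v} {x} lv adm x<v =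
  admissible-++[]⁺ v x adm (λ x∈v → <-irrefl refl (All.lookup x<v x∈v))
    (≤-reflexive (sym (layered-balanced lv x<v)))
    (noTwoBelow-unique x (proj₁ adm) (λ t∈v t<x → ⊥-elim (<-asym t<x (All.lookup x<v t∈v))))

layered-admissible : ∀ {w} → Layered w → Admissible w
layered-admissible [] = _ , _ , _ , _
layered-admissible (layer {v} {p} {q} lv p<q q<v) =
  subst Admissible (++-assoc v [ p ] [ q ]) (admissible-++[]⁺ (v ++ [ p ]) q adm-vp q∉ ballot noTwo)
  where
  p<v = All.map (<-trans p<q) q<v
  adm-vp = admissible-++-below lv (layered-admissible lv) p<v
  q∉ : q ∉ v ++ [ p ]
  q∉ q∈ with ∈-++⁻ v q∈
  ... | inj₁ q∈v = <-irrefl refl (All.lookup q<v q∈v)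
  ... | inj₂ (here refl) = <-irrefl refl p<q
  ballot : descents ((v ++ [ p ]) ++ [ q ]) ≤ ascents ((v ++ [ p ]) ++ [ q ])
  ballot rewrite ++-assoc v [ p ] [ q ] | ascents-++ v p [ q ] | descents-++ v p [ q ]
               | ascents-↑ [] p<q | descents-↑ [] p<q | layered-balanced lv p<v =
    +-monoʳ-≤ (descents (v ++ [ p ])) z≤n
  noTwo : NoTwoBelow (v ++ [ p ]) q
  noTwo = noTwoBelow-unique p (proj₁ adm-vp) onlyP
    where
    onlyP : ∀ {t} → t ∈ v ++ [ p ] → t < q → t ≡ p
    onlyP t∈ t<q with ∈-++⁻ v t∈
    ... | inj₁ t∈v = ⊥-elim (<-asym t<q (All.lookup q<v t∈v))
    ... | inj₂ (here t≡p) = t≡p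

descendingPairs-layered : ∀ b k → Layered (descendingPairs b k) × All (b ≤_) (descendingPairs b k)
descendingPairs-layered b zero = [] , []
descendingPairs-layered b (suc k) with descendingPairs-layered (suc (suc b)) k
... | layered , above =
  layer layered (n<1+n b) above ,
  All-++⁺ (All.map (λ 2+b≤t → <⇒≤ (<-trans (n<1+n b) 2+b≤t)) above) (≤-refl ∷ n≤1+n b ∷ [])

length-descendingPairs : ∀ b k → length (descendingPairs b k) ≡ double k
length-descendingPairs b zero = refl
length-descendingPairs b (suc k) =
  trans (length-++-pair (descendingPairs (suc (suc b)) k) b (suc b))
        (cong (suc ∘ suc) (length-descendingPairs (suc (suc b)) k))

descendingPairs-< : ∀ b k → All (_< b + double k) (descendingPairs b k)
descendingPairs-< b zero = []
descendingPairs-< b (suc k) =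
  All-++⁺ (All.map (λ {t} → subst (t <_) (sym (+-double-suc b k))) (descendingPairs-< (suc (suc b)) k))
          (<-trans (n<1+n b) 2+b≤top ∷ 2+b≤top ∷ [])
  where
  2+b≤top : suc (suc b) ≤ b + double (suc k)
  2+b≤top = subst (suc (suc b) ≤_) (sym (+-double-suc b k)) (m≤m+n (suc (suc b)) (double k))

-- Odd length

-- With {p , r} = {0 , 1} these are the two elements of B_(2k+3)(123,213); in the paper's 1-based
-- values they end in 2 3 1 and 1 3 2.
oddWord : ℕ → ℕ → ℕ → List ℕ
oddWord k p r = (descendingPairs 3 k ++ p ∷ 2 ∷ []) ++ [ r ]

oddWord-admissible : ∀ k {p r} → p < 2 → r < 2 → p ≢ r → Admissible (oddWord k p r)
oddWord-admissible k {p} {r} p<2 r<2 p≢r =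
  admissible-++[]⁺ v r (layered-admissible layered-v) (λ r∈ → p≢r (sym (onlyP r∈ r<2)))
    (≤-reflexive (sym (layer-balanced layered-u p<2 2<u r<2)))
    (noTwoBelow-unique p (proj₁ (layered-admissible layered-v)) (λ t∈ t<r → onlyP t∈ (<-trans t<r r<2)))
  where
  u = descendingPairs 3 k
  v = u ++ p ∷ 2 ∷ []
  layered-u = proj₁ (descendingPairs-layered 3 k)
  2<u = proj₂ (descendingPairs-layered 3 k)
  layered-v = layer layered-u p<2 2<u
  onlyP : ∀ {t} → t ∈ v → t < 2 → t ≡ p
  onlyP t∈ t<2 with ∈-++⁻ u t∈
  ... | inj₁ t∈u = ⊥-elim (<-asym t<2 (All.lookup 2<u t∈u))
  ... | inj₂ (here t≡p) = t≡p
  ... | inj₂ (there (here refl)) = ⊥-elim (<-irrefl refl t<2)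

oddWord-of-lowest-last : ∀ k {u r} → Layered u → length u ≡ double (suc k) → All (suc r ≤_) u →
  All (_< suc (double (suc k))) u → r < suc (double (suc k)) → u ++ [ r ] ≡ oddWord k 1 0
oddWord-of-lowest-last k lu len r<u u<n r<n with layered-floor {d = 1} lu len r<u u<n r<n
... | s≤s z≤n = cong (_++ [ 0 ]) (layered-unique (suc k) 1 lu len r<u u<n)

squeeze-0-1-2 : ∀ {p r q} → p < r → r < q → q ≤ 2 → p ≡ 0 × r ≡ 1 × q ≡ 2
squeeze-0-1-2 (s≤s z≤n) (s≤s (s≤s z≤n)) (s≤s (s≤s z≤n)) = refl , refl , refl

oddWord-of-middle-last : ∀ k {v p q r} → Layered v → length v ≡ double k → All (q <_) v → p < r → r < q →
  All (_< 3 + double k) (v ++ p ∷ q ∷ []) → (v ++ p ∷ q ∷ []) ++ [ r ] ≡ oddWord k 0 1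
oddWord-of-middle-last k {v} lv len q<v p<r r<q u<n with All-++-pair⁻ v u<n
... | v<n , _ , q<n with squeeze-0-1-2 p<r r<q (s≤s⁻¹ (layered-floor lv len q<v v<n q<n))
...   | refl , refl , refl = cong (λ v → (v ++ 0 ∷ 2 ∷ []) ++ [ 1 ]) (layered-unique k 3 lv len q<v v<n)

layered-++-last⇒oddWord : ∀ k {u r} → Layered u → length u ≡ double (suc k) → r ∉ u → NoTwoBelow u r →
  All (_< suc (double (suc k))) u → r < suc (double (suc k)) →
  u ++ [ r ] ≡ oddWord k 1 0 ⊎ u ++ [ r ] ≡ oddWord k 0 1
layered-++-last⇒oddWord k {r = r} (layer {v} {p} {q} lv p<q q<v) len r∉ noTwo u<n r<n
  with below-top v p<q r∉ noTwo | <-cmp r p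
... | r<q | tri< r<p _ _ =
  inj₁ (oddWord-of-lowest-last k (layer lv p<q q<v) len
          (All-++⁺ (All.map (<-trans r<q) q<v) (r<p ∷ r<q ∷ [])) u<n r<n)
... | _   | tri≈ _ refl _ = ⊥-elim (r∉ (∈-++⁺ʳ v (here refl)))
... | r<q | tri> _ _ p<r =
  inj₂ (oddWord-of-middle-last k lv (length-++-pair⁻ v len) q<v p<r r<q u<n)

admissible-odd⇒oddWord : ∀ k w → length w ≡ suc (double (suc k)) → All (_< suc (double (suc k))) w → Admissible w →
  w ≡ oddWord k 1 0 ⊎ w ≡ oddWord k 0 1
admissible-odd⇒oddWord k w len w<n adm with unsnoc-length w len
... | u , r , refl , len-u with admissible-++[]⁻ u r adm | ∷ʳ⁻ {xs = u} {x = r} w<n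
...   | adm-u , r∉u , _ , noTwo | u<n , r<n =
  layered-++-last⇒oddWord k (admissible-even⇒layered (suc k) u len-u adm-u) len-u r∉u noTwo u<n r<n

-- Counting

InB : ℕ → List ℕ → Set
InB n w = length w ≡ n × All (_< n) w × Admissible w

inB⇒Admissible : ∀ n σ → T (inB n σ) → Admissible (word σ)
inB⇒Admissible n σ h with Equivalence.to (T-∧ {allDistinct (word σ)}) h
... | d , h′ with Equivalence.to (T-∧ {isBallot (word σ)}) h′
...   | b , h″ with Equivalence.to (T-∧ {avoids (word σ) π123}) h″
...     | a₁₂₃ , a₂₁₃ = d , b , a₁₂₃ , a₂₁₃

Admissible⇒inB : ∀ n σ → Admissible (word σ) → T (inB n σ)
Admissible⇒inB n σ (d , b , a₁₂₃ , a₂₁₃) =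
  Equivalence.from T-∧ (d , Equivalence.from T-∧ (b , Equivalence.from T-∧ (a₁₂₃ , a₂₁₃)))

word-injective : ∀ {n m} (σ τ : Vec (Fin n) m) → map toℕ (toList σ) ≡ map toℕ (toList τ) → σ ≡ τ
word-injective []ᵥ []ᵥ _ = refl
word-injective (x ∷ᵥ σ) (y ∷ᵥ τ) eq =
  cong₂ _∷ᵥ_ (toℕ-injective (∷-injectiveˡ eq)) (word-injective σ τ (∷-injectiveʳ eq))

word-InB : ∀ n (σ : B-123-213 n) → InB n (word (proj₁ σ))
word-InB n (σ , h) = length-word σ , word-< σ , inB⇒Admissible n σ h
  where
  length-word : ∀ {m} (σ : Vec (Fin n) m) → length (map toℕ (toList σ)) ≡ m
  length-word []ᵥ = refl
  length-word (_ ∷ᵥ σ) = cong suc (length-word σ)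
  word-< : ∀ {m} (σ : Vec (Fin n) m) → All (_< n) (map toℕ (toList σ))
  word-< []ᵥ = []
  word-< (i ∷ᵥ σ) = toℕ<n i ∷ word-< σ

toFins : ∀ {n w} → All (_< n) w → Vec (Fin n) (length w)
toFins [] = []ᵥ
toFins (x<n ∷ w<n) = fromℕ< x<n ∷ᵥ toFins w<n

toℕ-toFins : ∀ {n w} (w<n : All (_< n) w) → map toℕ (toList (toFins w<n)) ≡ w
toℕ-toFins [] = refl
toℕ-toFins (x<n ∷ w<n) = cong₂ _∷_ (toℕ-fromℕ< x<n) (toℕ-toFins w<n)

fromWord : ∀ {n} w → length w ≡ n → All (_< n) w → Vec (Fin n) n
fromWord _ refl w<n = toFins w<n

word-fromWord : ∀ {n} w (len : length w ≡ n) (w<n : All (_< n) w) → word (fromWord w len w<n) ≡ w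
word-fromWord _ refl w<n = toℕ-toFins w<n

B-≡ : ∀ {n} {x y : B-123-213 n} → proj₁ x ≡ proj₁ y → x ≡ y
B-≡ {x = σ , p} {y = .σ , q} refl = cong (σ ,_) (T-irrelevant p q)

B↔Fin : ∀ {n m} (e : Fin m → List ℕ) → (∀ i → InB n (e i)) → (∀ {i j} → e i ≡ e j → i ≡ j) →
  (∀ {w} → InB n w → ∃[ i ] w ≡ e i) → B-123-213 n ↔ Fin m
B↔Fin {n} e e-InB e-injective e-complete = mk↔ₛ′ index element index-element element-index
  where
  element : Fin _ → B-123-213 n
  element i = let (len , <n , adm) = e-InB i; σ = fromWord (e i) len <n
              in σ , Admissible⇒inB n σ (subst Admissible (sym (word-fromWord (e i) len <n)) adm)
  word-element : ∀ i → word (proj₁ (element i)) ≡ e i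
  word-element i = let (len , <n , _) = e-InB i in word-fromWord (e i) len <n
  index : B-123-213 n → Fin _
  index σ = proj₁ (e-complete (word-InB n σ))
  index-element : ∀ i → index (element i) ≡ i
  index-element i = e-injective (trans (sym (proj₂ (e-complete (word-InB n (element i))))) (word-element i))
  element-index : ∀ σ → element (index σ) ≡ σ
  element-index σ =
    B-≡ (word-injective _ (proj₁ σ) (trans (word-element (index σ)) (sym (proj₂ (e-complete (word-InB n σ))))))

B↔Fin1 : ∀ {n} w → InB n w → (∀ {v} → InB n v → v ≡ w) → B-123-213 n ↔ Fin 1
B↔Fin1 w w-InB only = B↔Fin (λ _ → w) (λ _ → w-InB) Fin1-unique (λ v-InB → fzero , only v-InB)
  where
  Fin1-unique : ∀ {i j : Fin 1} → w ≡ w → i ≡ j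
  Fin1-unique {fzero} {fzero} _ = refl

B₁↔Fin1 : B-123-213 1 ↔ Fin 1
B₁↔Fin1 = B↔Fin1 (0 ∷ []) (refl , s≤s z≤n ∷ [] , _ , _ , _ , _) only
  where
  only : ∀ {w} → InB 1 w → w ≡ 0 ∷ []
  only {_ ∷ []} (refl , s≤s z≤n ∷ [] , _) = refl

B-even↔Fin1 : ∀ k → B-123-213 (double (suc k)) ↔ Fin 1
B-even↔Fin1 k = B↔Fin1 (descendingPairs 0 (suc k))
  ( length-descendingPairs 0 (suc k) , descendingPairs-< 0 (suc k)
  , layered-admissible (proj₁ (descendingPairs-layered 0 (suc k))) )
  (λ {w} (len , w<n , adm) →
     layered-unique (suc k) 0 (admissible-even⇒layered (suc k) w len adm) len (All.tabulate (λ _ → z≤n)) w<n)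

oddWord-InB : ∀ k {p r} → p < 2 → r < 2 → p ≢ r → InB (suc (double (suc k))) (oddWord k p r)
oddWord-InB k {p} {r} p<2 r<2 p≢r = length-oddWord , oddWord-< , oddWord-admissible k p<2 r<2 p≢r
  where
  length-oddWord : length (oddWord k p r) ≡ suc (double (suc k))
  length-oddWord = trans (length-++ (descendingPairs 3 k ++ p ∷ 2 ∷ []))
    (trans (+-comm _ 1) (cong suc (trans (length-++-pair (descendingPairs 3 k) p 2)
                                          (cong (suc ∘ suc) (length-descendingPairs 3 k)))))
  oddWord-< : All (_< suc (double (suc k))) (oddWord k p r)
  oddWord-< = All-++⁺ (All-++⁺ (descendingPairs-< 3 k) (<3⇒<n (<-trans p<2 (n<1+n 2)) ∷ <3⇒<n (n<1+n 2) ∷ []))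
                      (<3⇒<n (<-trans r<2 (n<1+n 2)) ∷ [])
    where
    <3⇒<n : ∀ {t} → t < 3 → t < 3 + double k
    <3⇒<n t<3 = ≤-trans t<3 (m≤m+n 3 (double k))

B-odd↔Fin2 : ∀ k → B-123-213 (suc (double (suc k))) ↔ Fin 2
B-odd↔Fin2 k = B↔Fin e e-InB e-injective only
  where
  e : Fin 2 → List ℕ
  e fzero = oddWord k 1 0
  e (fsuc _) = oddWord k 0 1
  e-InB : ∀ i → InB (suc (double (suc k))) (e i)
  e-InB fzero = oddWord-InB k (n<1+n 1) (s≤s z≤n) (λ ())
  e-InB (fsuc fzero) = oddWord-InB k (s≤s z≤n) (n<1+n 1) (λ ())
  e-injective : ∀ {i j} → e i ≡ e j → i ≡ j
  e-injective {fzero} {fzero} _ = refl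
  e-injective {fsuc fzero} {fsuc fzero} _ = refl
  e-injective {fzero} {fsuc fzero} eq with ∷ʳ-injective (descendingPairs 3 k ++ 1 ∷ 2 ∷ []) _ eq
  ... | _ , ()
  e-injective {fsuc fzero} {fzero} eq with ∷ʳ-injective (descendingPairs 3 k ++ 0 ∷ 2 ∷ []) _ eq
  ... | _ , ()
  only : ∀ {w} → InB (suc (double (suc k))) w → ∃[ i ] w ≡ e i
  only {w} (len , w<n , adm) with admissible-odd⇒oddWord k w len w<n adm
  ... | inj₁ w≡ = fzero , w≡
  ... | inj₂ w≡ = fsuc fzero , w≡

data Parity : ℕ → Set where
  even : ∀ k → Parity (double k)
  odd  : ∀ k → Parity (suc (double k))

parity : ∀ n → Parity n
parity zero = even zero
parity (suc n) with parity n
... | even k = odd k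
... | odd k = even (suc k)

isEven-double : ∀ k → isEven (double k) ≡ true
isEven-double zero = refl
isEven-double (suc k) = isEven-double k

isEven-suc-double : ∀ k → isEven (suc (double k)) ≡ false
isEven-suc-double zero = refl
isEven-suc-double (suc k) = isEven-suc-double k

theorem3p3 : (n : ℕ) → 1 ≤ n → B-123-213 n ↔ Fin (a n)
theorem3p3 (suc zero) _ = B₁↔Fin1
theorem3p3 (suc (suc n)) _ with parity n
... | even k rewrite isEven-double k = B-even↔Fin1 k
... | odd k rewrite isEven-suc-double k = B-odd↔Fin2 k
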